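{- Let $H$ be a Heyting algebra and $\mathbf{S}=\{x\in H : x\vee\neg x\neq\top\}$ its set of non-central elements. If $s\in\mathbf{S}$ is maximal in $\mathbf{S}$ (i.e. for every $s'\in\mathbf{S}$, $s\le s'$ implies $s=s'$), then $\neg s=\bot$.
   Context: $\neg x$ abbreviates $x\to\bot$. -}

module Defs where

open import Level using (Level; _⊔_)
open import Relation.Nullary using (¬_)
open import Relation.Binary.Lattice using (HeytingAlgebra)

module _ {c ℓ₁ ℓ₂ : Level} (H : HeytingAlgebra c ℓ₁ ℓ₂) where
  open HeytingAlgebra H

  neg : Carrier → Carrier
  neg x = x ⇨ ⊥

  NonCentral : Carrier → Set ℓ₁
  NonCentral x = ¬ ((x ∨ neg x) ≈ ⊤)

  MaximalNonCentral : Carrier → Set (c ⊔ ℓ₁ ⊔ ℓ₂)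
  MaximalNonCentral s =
    NonCentral s × (∀ s′ → NonCentral s′ → s ≤ s′ → s ≈ s′)
    where open import Data.Product using (_×_)

-- The excluded-middle element t = s ∨ ¬s is dense (¬t = ⊥), so t ∨ ¬t = t, and t is
-- non-central exactly because s is. As s ≤ t, maximality forces s = t, i.e. ¬s ≤ s,
-- and then ¬s ≤ s ∧ ¬s ≤ ⊥.
module Submission where

open import Defs
open import Level using (Level)
open import Relation.Binary.Lattice using (HeytingAlgebra)
open import Data.Product using (_,_)

module _ {c ℓ₁ ℓ₂ : Level} (H : HeytingAlgebra c ℓ₁ ℓ₂) where
  open HeytingAlgebra H renaming (refl to ≤-refl; trans to ≤-trans)
  open import Relation.Binary.Lattice.Properties.HeytingAlgebra H
    using (¬_; ⇨-eval; ⇨-applyʳ; de-morgan₁)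
  open import Relation.Binary.Lattice.Properties.MeetSemilattice meetSemilattice
    using (∧-comm)
  import Relation.Binary.Reasoning.PartialOrder poset as ≤-Reasoning

  ≤⊥⇒≈⊥ : ∀ {x} → x ≤ ⊥ → x ≈ ⊥
  ≤⊥⇒≈⊥ x≤⊥ = antisym x≤⊥ (minimum _)

  ¬[x∨¬x]≈⊥ : ∀ x → ¬ (x ∨ ¬ x) ≈ ⊥
  ¬[x∨¬x]≈⊥ x = ≤⊥⇒≈⊥ (begin
    ¬ (x ∨ ¬ x)   ≈⟨ de-morgan₁ x (¬ x) ⟩
    ¬ x ∧ ¬ ¬ x   ≈⟨ ∧-comm _ _ ⟩
    ¬ ¬ x ∧ ¬ x   ≤⟨ ⇨-eval ⟩
    ⊥             ∎)
    where open ≤-Reasoning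

  ¬x≈⊥⇒x∨¬x≈x : ∀ {x} → ¬ x ≈ ⊥ → x ∨ ¬ x ≈ x
  ¬x≈⊥⇒x∨¬x≈x {x} ¬x≈⊥ =
    antisym (∨-least ≤-refl (≤-trans (reflexive ¬x≈⊥) (minimum x))) (x≤x∨y x (¬ x))

  ¬x≤x⇒¬x≈⊥ : ∀ {x} → ¬ x ≤ x → ¬ x ≈ ⊥
  ¬x≤x⇒¬x≈⊥ {x} ¬x≤x = ≤⊥⇒≈⊥ (begin
    ¬ x         ≤⟨ ∧-greatest ¬x≤x ≤-refl ⟩
    x ∧ ¬ x     ≤⟨ ⇨-applyʳ ≤-refl ⟩
    ⊥           ∎)
    where open ≤-Reasoning

  x∨¬x-nonCentral : ∀ {x} → NonCentral H x → NonCentral H (x ∨ ¬ x)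
  x∨¬x-nonCentral {x} nc central = nc (Eq.trans (Eq.sym (¬x≈⊥⇒x∨¬x≈x (¬[x∨¬x]≈⊥ x))) central)

  maximalNonCentral⇒¬≈⊥ : ∀ {s} → MaximalNonCentral H s → ¬ s ≈ ⊥
  maximalNonCentral⇒¬≈⊥ {s} (nc , maximal) = ¬x≤x⇒¬x≈⊥ (begin
    ¬ s       ≤⟨ y≤x∨y s (¬ s) ⟩
    s ∨ ¬ s   ≈⟨ Eq.sym (maximal (s ∨ ¬ s) (x∨¬x-nonCentral nc) (x≤x∨y s (¬ s))) ⟩
    s         ∎)
    where open ≤-Reasoning

lemma4p4 : {c ℓ₁ ℓ₂ : Level} (H : HeytingAlgebra c ℓ₁ ℓ₂) (s : HeytingAlgebra.Carrier H) →
    MaximalNonCentral H s → HeytingAlgebra._≈_ H (neg H s) (HeytingAlgebra.⊥ H)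
lemma4p4 H s = maximalNonCentral⇒¬≈⊥ H
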